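{- Let $k\ge 2$ and $r\ge 2$ be integers and $n=k^2$. If there exists a $2$-$(k^2,k,1)$ resolvable packing with at least $r$ parallel classes, then $\theta^{c}(\mathcal{K}_{n^{[r]}})=2n$, where $\mathcal{K}_{n^{[r]}}$ denotes the complete $r$-partite graph $\mathcal{K}_{n,\ldots,n}$ with $r$ parts each of size $n$.
   Context: Graphs are finite, simple and undirected. For a graph $\mathcal{G}=(\mathcal{V},\mathcal{E})$ and positive integers $\alpha,\beta$, an $(\alpha\mid\beta)$-cointersection representation (CIR) of $\mathcal{G}$ consists of two disjoint finite sets of features $\mathcal{A},\mathcal{B}$ with $|\mathcal{A}|=\alpha$, $|\mathcal{B}|=\beta$, together with an assignment to each vertex $v$ of subsets $A_v\subseteq\mathcal{A}$, $B_v\subseteq\mathcal{B}$ (possibly empty), such that for all distinct $u,v\in\mathcal{V}$: $(u,v)\in\mathcal{E}$ if and only if $A_u\cap A_v\neq\varnothing$ and $B_u\cap B_v\neq\varnothing$. The cointersection number $\theta^{c}(\mathcal{G})$ is the minimum of $\alpha+\beta$ over all CIRs of $\mathcal{G}$. For $m\ge k\ge 2$, a $2$-$(m,k,1)$ packing is a pair $(\mathcal{X},\mathcal{S})$ where $\mathcal{X}$ is a set of $m$ points and $\mathcal{S}$ is a collection of $k$-element subsets of $\mathcal{X}$ (blocks) such that every pair of distinct points is contained in at most one block. It is resolvable if $\mathcal{S}$ can be partitioned into parallel classes, each consisting of $m/k$ blocks that partition $\mathcal{X}$. -}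

module Defs where

open import Data.Nat using (ℕ; _*_; _+_; _≤_)
open import Data.Fin using (Fin)
open import Data.Fin.Subset using (Subset; _∈_; ∣_∣)
open import Data.Product using (_×_; Σ; ∃-syntax; _,_)
open import Relation.Binary.PropositionalEquality using (_≡_; _≢_)
open import Function.Bundles using (_⇔_)
open import Relation.Nullary using (¬_)

record Graph : Set₁ where
  field
    N      : ℕ
    Adj    : Fin N → Fin N → Set
    sym    : ∀ {u v} → Adj u v → Adj v u
    irrefl : ∀ {u} → ¬ Adj u u
open Graph public

Meets : ∀ {a} → Subset a → Subset a → Set
Meets A B = ∃[ x ] (x ∈ A × x ∈ B)

-- An (α | β)-cointersection representation of G, with feature sets
-- 𝒜 = Fin α and ℬ = Fin β (disjoint by construction), α, β positive.
record CIR (G : Graph) (α β : ℕ) : Set where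
  field
    α-pos : 1 ≤ α
    β-pos : 1 ≤ β
    A     : Fin (N G) → Subset α
    B     : Fin (N G) → Subset β
    rep   : ∀ u v → u ≢ v → (Adj G u v ⇔ (Meets (A u) (A v) × Meets (B u) (B v)))

CointersectionNumberIs : Graph → ℕ → Set
CointersectionNumberIs G t =
  (Σ ℕ λ α → Σ ℕ λ β → CIR G α β × α + β ≡ t)
  × (∀ α β → CIR G α β → t ≤ α + β)

-- Complete r-partite graph with r parts each of size n.
-- Vertex i * n + j  (i < r, j < n) is encoded via Data.Fin.combine;
-- two vertices are adjacent iff they lie in different parts.
open import Data.Fin using (remQuot)
open import Data.Product using (proj₁)

CompleteMultipartite : (r n : ℕ) → Graph
CompleteMultipartite r n = record
  { N      = r * n
  ; Adj    = λ u v → proj₁ (remQuot {r} n u) ≢ proj₁ (remQuot {r} n v)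
  ; sym    = λ p q → p (Relation.Binary.PropositionalEquality.sym q)
  ; irrefl = λ p → p Relation.Binary.PropositionalEquality.refl
  }

record ResolvablePacking (m k c : ℕ) : Set where
  field
    q         : ℕ
    q*k≡m     : q * k ≡ m
    block     : Fin c → Fin q → Subset m
    blockSize : ∀ i j → ∣ block i j ∣ ≡ k
    covers    : ∀ i (x : Fin m) → ∃[ j ] (x ∈ block i j)
    disjoint  : ∀ i (x : Fin m) j j' → x ∈ block i j → x ∈ block i j' → j ≡ j'
    packing   : ∀ (x y : Fin m) → x ≢ y → ∀ i j i' j' →
                x ∈ block i j → y ∈ block i j →
                x ∈ block i' j' → y ∈ block i' j' →
                (i , j) ≡ (i' , j')

module Submission where

-- Lower bound (any r ≥ 2).  In a CIR of a complete multipartite graph two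
-- distinct vertices of the same part never share both an A-feature and a
-- B-feature, while a vertex of part 0 and a vertex of part 1 always do.
-- Choosing such a shared pair (a , b) for every (j , j') ∈ Fin n × Fin n
-- therefore gives an injection Fin n × Fin n → Fin α × Fin β, so
-- n² ≤ αβ ≤ ((α + β)/2)², i.e. 2n ≤ α + β.
--
-- Upper bound.  In a resolvable packing with q blocks per class and q ≤ k,
-- blocks of different classes always meet: the k points of one block lie in
-- pairwise different blocks of another class (packing property), so they
-- cannot all avoid one of its q ≤ k blocks.  For m = k² we have q = k, so
-- write the index of a vertex of part p as a pair (s , t) ∈ Fin k × Fin k
-- and give it the s-th and the t-th block of class p as A- and B-sets.

open import Defs hiding (sym)
open import Data.Nat using (ℕ; zero; suc; _+_; _*_; _∸_; _≤_; _<_; z≤n; s≤s; NonZero; >-nonZero⁻¹)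
open import Data.Nat.Properties
  using (≤-trans; ≤-reflexive; <⇒≱; ≤-total; _≤?_; ≰⇒>; *-monoʳ-≤; *-mono-<;
         *-comm; +-comm; +-identityʳ; m≤m+n; m+[n∸m]≡n; *-cancelʳ-≡; m*n≢0)
open import Data.Nat.Solver using (module +-*-Solver)
open import Data.Fin using (Fin; zero; suc; punchOut; remQuot; combine; cast; inject≤)
open import Data.Fin.Properties
  using (punchOut-injective; remQuot-combine; combine-remQuot; combine-injective;
         combine-injectiveʳ; inject≤-injective; cast-involutive; any?; injective⇒≤)
  renaming (suc-injective to Fin-suc-injective; _≟_ to _≟ᶠ_)
open import Data.Fin.Subset using (Subset; _∈_; ∣_∣; inside; outside)
open import Data.Fin.Subset.Properties using (_∈?_)
open import Data.Vec using (_∷_; [])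
open import Data.Vec.Base using (here; there)
open import Data.Product using (Σ; _×_; _,_; proj₁; proj₂)
open import Data.Sum using (inj₁; inj₂)
open import Data.Empty using (⊥-elim)
open import Relation.Nullary using (yes; no)
open import Relation.Nullary.Decidable using (_×-dec_)
open import Relation.Binary.PropositionalEquality
  using (_≡_; _≢_; refl; sym; trans; cong; cong₂; subst; subst₂)
open import Function.Bundles using (_⇔_; mk⇔; Equivalence)

members-injection⇒≤ : ∀ {m p} (S : Subset m) (f : ∀ x → x ∈ S → Fin p) →
                      (∀ x y px py → f x px ≡ f y py → x ≡ y) → ∣ S ∣ ≤ p
members-injection⇒≤ [] f inj = z≤n
members-injection⇒≤ (outside ∷ S) f inj =
  members-injection⇒≤ S (λ x px → f (suc x) (there px))
    (λ x y px py e → Fin-suc-injective (inj _ _ _ _ e))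
members-injection⇒≤ {p = zero} (inside ∷ S) f inj with f zero here
... | ()
members-injection⇒≤ {p = suc p} (inside ∷ S) f inj = s≤s (members-injection⇒≤ S g g-injective)
  where
  avoids : ∀ x px → f zero here ≢ f (suc x) (there px)
  avoids x px e with inj _ _ _ _ e
  ... | ()
  g : ∀ x → x ∈ S → Fin p
  g x px = punchOut (avoids x px)
  g-injective : ∀ x y px py → g x px ≡ g y py → x ≡ y
  g-injective x y px py e =
    Fin-suc-injective (inj _ _ _ _ (punchOut-injective (avoids x px) (avoids y py) e))

members-injection-missing⇒< : ∀ {m q} (S : Subset m) (f : Fin m → Fin q) →
    (∀ x y → x ∈ S → y ∈ S → f x ≡ f y → x ≡ y) →
    (t : Fin q) → (∀ x → x ∈ S → f x ≢ t) → ∣ S ∣ < q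
members-injection-missing⇒< {q = suc q} S f inj t avoids =
  s≤s (members-injection⇒≤ S (λ x px → punchOut (t≢f x px))
         (λ x y px py e → inj x y px py (punchOut-injective (t≢f x px) (t≢f y py) e)))
  where
  t≢f : ∀ x → x ∈ S → t ≢ f x
  t≢f x px e = avoids x px (sym e)

remQuot-injective : ∀ {a} b {x y : Fin (a * b)} →
                    proj₁ (remQuot {a} b x) ≡ proj₁ (remQuot {a} b y) →
                    proj₂ (remQuot {a} b x) ≡ proj₂ (remQuot {a} b y) → x ≡ y
remQuot-injective {a} b {x} {y} e₁ e₂ =
  trans (sym (combine-remQuot {a} b x)) (trans (cong₂ combine e₁ e₂) (combine-remQuot {a} b y))

cast-injective : ∀ {m n} .(eq : m ≡ n) {x y : Fin m} → cast eq x ≡ cast eq y → x ≡ y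
cast-injective eq {x} {y} e =
  trans (sym (cast-involutive (sym eq) eq x))
        (trans (cong (cast (sym eq)) e) (cast-involutive (sym eq) eq y))

module _ where
  open +-*-Solver using (solve; _:+_; _:*_; con; _:=_)

  square-of-sum-identity : ∀ a d → 4 * (a * (a + d)) + d * d ≡ (a + (a + d)) * (a + (a + d))
  square-of-sum-identity = solve 2 (λ a d →
    con 4 :* (a :* (a :+ d)) :+ d :* d := (a :+ (a :+ d)) :* (a :+ (a :+ d))) refl

  square-of-double : ∀ n → (2 * n) * (2 * n) ≡ 4 * (n * n)
  square-of-double = solve 1 (λ n → (con 2 :* n) :* (con 2 :* n) := con 4 :* (n :* n)) refl

-- The AM–GM inequality 4ab ≤ (a + b)², first for a ≤ b, writing b = a + d.
four-product≤square-sum-ordered : ∀ a b → a ≤ b → 4 * (a * b) ≤ (a + b) * (a + b)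
four-product≤square-sum-ordered a b a≤b =
  subst (λ z → 4 * (a * z) ≤ (a + z) * (a + z)) (m+[n∸m]≡n a≤b)
        (subst (4 * (a * (a + (b ∸ a))) ≤_) (square-of-sum-identity a (b ∸ a)) (m≤m+n _ _))

four-product≤square-sum : ∀ a b → 4 * (a * b) ≤ (a + b) * (a + b)
four-product≤square-sum a b with ≤-total a b
... | inj₁ a≤b = four-product≤square-sum-ordered a b a≤b
... | inj₂ b≤a =
  subst₂ (λ u v → 4 * u ≤ v) (*-comm b a) (cong₂ _*_ (+-comm b a) (+-comm b a))
         (four-product≤square-sum-ordered b a b≤a)

square-reflects-≤ : ∀ m n → m * m ≤ n * n → m ≤ n
square-reflects-≤ m n mm≤nn with m ≤? n
... | yes m≤n = m≤n
... | no m≰n = ⊥-elim (<⇒≱ (*-mono-< n<m n<m) mm≤nn)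
  where n<m = ≰⇒> m≰n

square≤product⇒double≤sum : ∀ n a b → n * n ≤ a * b → 2 * n ≤ a + b
square≤product⇒double≤sum n a b nn≤ab = square-reflects-≤ (2 * n) (a + b)
  (≤-trans (≤-reflexive (square-of-double n))
    (≤-trans (*-monoʳ-≤ 4 nn≤ab) (four-product≤square-sum a b)))

module PackingProperties {m k c : ℕ} (P : ResolvablePacking m k c) where
  open ResolvablePacking P

  blockOf : Fin c → Fin m → Fin q
  blockOf i x = proj₁ (covers i x)

  separated : ∀ {i i'} → i ≢ i' → ∀ t x y → x ∈ block i t → y ∈ block i t →
              blockOf i' x ≡ blockOf i' y → x ≡ y
  separated {i} {i'} i≢i' t x y x∈ y∈ e with x ≟ᶠ y
  ... | yes x≡y = x≡y
  ... | no x≢y = ⊥-elim (i≢i' (cong proj₁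
          (packing x y x≢y i t i' (blockOf i' x) x∈ y∈ (proj₂ (covers i' x))
                   (subst (λ j → y ∈ block i' j) (sym e) (proj₂ (covers i' y))))))

  blocks-meet : q ≤ k → ∀ {i i'} → i ≢ i' → ∀ t t' → Meets (block i t) (block i' t')
  blocks-meet q≤k {i} {i'} i≢i' t t'
    with any? (λ x → (x ∈? block i t) ×-dec (x ∈? block i' t'))
  ... | yes common = common
  ... | no disjoint-blocks = ⊥-elim (<⇒≱ k<q q≤k)
    where
    misses : ∀ x → x ∈ block i t → blockOf i' x ≢ t'
    misses x x∈ e = disjoint-blocks (x , x∈ , subst (λ j → x ∈ block i' j) e (proj₂ (covers i' x)))
    k<q : k < q
    k<q = subst (_< q) (blockSize i t)
            (members-injection-missing⇒< (block i t) (blockOf i')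
               (λ x y → separated i≢i' t x y) t' misses)

packing⇒CIR : ∀ {k c r} .{{_ : NonZero k}} → r ≤ c → ResolvablePacking (k * k) k c →
              CIR (CompleteMultipartite r (k * k)) (k * k) (k * k)
packing⇒CIR {k} {c} {r} r≤c P = record
  { α-pos = >-nonZero⁻¹ (k * k) {{m*n≢0 k k}}
  ; β-pos = >-nonZero⁻¹ (k * k) {{m*n≢0 k k}}
  ; A = λ u → block (class u) (row u)
  ; B = λ u → block (class u) (column u)
  ; rep = represents
  }
  where
  open ResolvablePacking P
  open PackingProperties P
  G : Graph
  G = CompleteMultipartite r (k * k)

  q≡k : q ≡ k
  q≡k = *-cancelʳ-≡ q k k q*k≡m

  part : Fin (r * (k * k)) → Fin r
  part u = proj₁ (remQuot {r} (k * k) u)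
  index : Fin (r * (k * k)) → Fin (k * k)
  index u = proj₂ (remQuot {r} (k * k) u)
  class : Fin (r * (k * k)) → Fin c
  class u = inject≤ (part u) r≤c
  -- the index of a vertex, written as a cell (row , column) of a k × k grid
  row column : Fin (r * (k * k)) → Fin q
  row u = cast (sym q≡k) (proj₁ (remQuot {k} k (index u)))
  column u = cast (sym q≡k) (proj₂ (remQuot {k} k (index u)))

  same-cell⇒equal : ∀ {u v} → part u ≡ part v → row u ≡ row v → column u ≡ column v → u ≡ v
  same-cell⇒equal {u} {v} ep er ec = remQuot-injective {r} (k * k) ep
    (remQuot-injective {k} k (cast-injective (sym q≡k) er) (cast-injective (sym q≡k) ec))

  represents : ∀ u v → u ≢ v →
    (Adj G u v ⇔ (Meets (block (class u) (row u)) (block (class v) (row v))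
                × Meets (block (class u) (column u)) (block (class v) (column v))))
  represents u v u≢v = mk⇔ adjacent⇒meet meet⇒adjacent
    where
    adjacent⇒meet : Adj G u v →
      Meets (block (class u) (row u)) (block (class v) (row v))
      × Meets (block (class u) (column u)) (block (class v) (column v))
    adjacent⇒meet adj = blocks-meet q≤k class≢ (row u) (row v)
                      , blocks-meet q≤k class≢ (column u) (column v)
      where
      q≤k : q ≤ k
      q≤k = ≤-reflexive q≡k
      class≢ : class u ≢ class v
      class≢ e = adj (inject≤-injective _ _ _ _ e)
    -- in one parallel class a point lies in a unique block
    meet⇒adjacent :
      Meets (block (class u) (row u)) (block (class v) (row v))
      × Meets (block (class u) (column u)) (block (class v) (column v)) → Adj G u v
    meet⇒adjacent ((x , x∈u , x∈v) , (y , y∈u , y∈v)) same-part =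
      u≢v (same-cell⇒equal same-part
             (disjoint (class u) x (row u) (row v) x∈u (subst (λ i → x ∈ block i (row v)) (sym same-class) x∈v))
             (disjoint (class u) y (column u) (column v) y∈u (subst (λ i → y ∈ block i (column v)) (sym same-class) y∈v)))
      where
      same-class : class u ≡ class v
      same-class = cong (λ p → inject≤ p r≤c) same-part

module LowerBound {r' n α β : ℕ} (C : CIR (CompleteMultipartite (suc (suc r')) n) α β) where
  open CIR C
  r : ℕ
  r = suc (suc r')

  vertex : Fin r → Fin n → Fin (r * n)
  vertex = combine

  part-of-vertex : ∀ p j → proj₁ (remQuot {r} n (vertex p j)) ≡ p
  part-of-vertex p j = cong proj₁ (remQuot-combine p j)

  -- distinct vertices of one part are non-adjacent, so they cannot share both kinds of feature
  shared-in-part⇒equal : ∀ p j j' → Meets (A (vertex p j)) (A (vertex p j')) →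
                         Meets (B (vertex p j)) (B (vertex p j')) → j ≡ j'
  shared-in-part⇒equal p j j' meetA meetB with j ≟ᶠ j'
  ... | yes j≡j' = j≡j'
  ... | no j≢j' = ⊥-elim (Equivalence.from (rep _ _ distinct) (meetA , meetB)
                    (trans (part-of-vertex p j) (sym (part-of-vertex p j'))))
    where
    distinct : vertex p j ≢ vertex p j'
    distinct e = j≢j' (combine-injectiveʳ p j p j' e)

  -- vertices of parts 0 and 1 are adjacent, so they share an A- and a B-feature
  shared-across : ∀ j j' → Meets (A (vertex zero j)) (A (vertex (suc zero) j'))
                         × Meets (B (vertex zero j)) (B (vertex (suc zero) j'))
  shared-across j j' = Equivalence.to (rep _ _ distinct) adjacent
    where
    adjacent : Adj (CompleteMultipartite r n) (vertex zero j) (vertex (suc zero) j')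
    adjacent e with trans (sym (part-of-vertex zero j)) (trans e (part-of-vertex (suc zero) j'))
    ... | ()
    distinct : vertex zero j ≢ vertex (suc zero) j'
    distinct e = adjacent (cong (λ w → proj₁ (remQuot {r} n w)) e)

  -- x ∈ Fin (n * n) encodes the cross pair (vertex 0 (left x) , vertex 1 (right x))
  left right : Fin (n * n) → Fin n
  left x = proj₁ (remQuot {n} n x)
  right x = proj₂ (remQuot {n} n x)

  featureA : Fin (n * n) → Fin α
  featureA x = proj₁ (proj₁ (shared-across (left x) (right x)))
  featureB : Fin (n * n) → Fin β
  featureB x = proj₁ (proj₂ (shared-across (left x) (right x)))

  featureA∈ : ∀ x → featureA x ∈ A (vertex zero (left x)) × featureA x ∈ A (vertex (suc zero) (right x))
  featureA∈ x = proj₂ (proj₁ (shared-across (left x) (right x)))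
  featureB∈ : ∀ x → featureB x ∈ B (vertex zero (left x)) × featureB x ∈ B (vertex (suc zero) (right x))
  featureB∈ x = proj₂ (proj₂ (shared-across (left x) (right x)))

  witness : Fin (n * n) → Fin (α * β)
  witness x = combine (featureA x) (featureB x)

  witness-injective : ∀ {x y} → witness x ≡ witness y → x ≡ y
  witness-injective {x} {y} e = remQuot-injective {n} n
    (shared-in-part⇒equal zero (left x) (left y)
       (featureA x , proj₁ (featureA∈ x) , subst (_∈ A (vertex zero (left y))) (sym a≡) (proj₁ (featureA∈ y)))
       (featureB x , proj₁ (featureB∈ x) , subst (_∈ B (vertex zero (left y))) (sym b≡) (proj₁ (featureB∈ y))))
    (shared-in-part⇒equal (suc zero) (right x) (right y)
       (featureA x , proj₂ (featureA∈ x) , subst (_∈ A (vertex (suc zero) (right y))) (sym a≡) (proj₂ (featureA∈ y)))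
       (featureB x , proj₂ (featureB∈ x) , subst (_∈ B (vertex (suc zero) (right y))) (sym b≡) (proj₂ (featureB∈ y))))
    where
    a≡ : featureA x ≡ featureA y
    a≡ = proj₁ (combine-injective (featureA x) (featureB x) (featureA y) (featureB y) e)
    b≡ : featureB x ≡ featureB y
    b≡ = proj₂ (combine-injective (featureA x) (featureB x) (featureA y) (featureB y) e)

  cointersection-lower : 2 * n ≤ α + β
  cointersection-lower = square≤product⇒double≤sum n α β (injective⇒≤ witness-injective)

theorem6 : (k r : ℕ) → 2 ≤ k → 2 ≤ r →
    (Σ ℕ λ c → r ≤ c × ResolvablePacking (k * k) k c) →
    CointersectionNumberIs (CompleteMultipartite r (k * k)) (2 * (k * k))
theorem6 k@(suc _) (suc (suc r)) (s≤s (s≤s _)) (s≤s (s≤s _)) (c , r≤c , P) =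
  (n , n , packing⇒CIR r≤c P , n+n≡2n)
  , (λ α β C → LowerBound.cointersection-lower {r} {n} C)
  where
  n : ℕ
  n = k * k
  n+n≡2n : n + n ≡ 2 * n
  n+n≡2n = cong (n +_) (sym (+-identityʳ n))
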